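{- Let $p,q,r$ be distinct odd primes. Among the three inequalities $$q^{ -1}(p)+r^{ -1}(p)>p,\qquad r^{ -1}(q)+p^{ -1}(q)>q,\qquad p^{ -1}(r)+q^{ -1}(r)>r,$$ exactly one or exactly two hold.
   Context: For coprime integers $a,b$ with $b>1$, $a^{ -1}(b)$ denotes the inverse of $a$ modulo $b$, taken in $\{1,\dots,b-1\}$. -}

module Defs where

open import Data.Nat using (ℕ; _+_; _*_; _<_; _≤_; NonZero; _<ᵇ_)
open import Data.Nat.DivMod using (_%_)
open import Data.Bool using (Bool; true; false; if_then_else_)
open import Data.Product using (_×_)
open import Relation.Binary.PropositionalEquality using (_≡_)

IsInvMod : (a b x : ℕ) → .{{NonZero b}} → Set
IsInvMod a b x = (1 ≤ x) × (x < b) × ((a * x) % b ≡ 1 % b)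

ind : Bool → ℕ
ind b = if b then 1 else 0

countGreater : (u₁ v₁ m₁ u₂ v₂ m₂ u₃ v₃ m₃ : ℕ) → ℕ
countGreater u₁ v₁ m₁ u₂ v₂ m₂ u₃ v₃ m₃ =
  ind (m₁ <ᵇ u₁ + v₁) + ind (m₂ <ᵇ u₂ + v₂) + ind (m₃ <ᵇ u₃ + v₃)

module Submission where

-- For coprime m, n > 1 write a = n⁻¹(m) and b = m⁻¹(n).
-- The number x = n·a + m·b is ≡ 1 both mod m and mod n, hence x - 1 is a
-- multiple of m·n; since 2 ≤ x < 2·m·n this forces
--     n·a + m·b = 1 + m·n.                                   (pair identity)
-- Weighting the three sums of the theorem by q·r, r·p and p·q and applying
-- the pair identity to each pair of primes gives the balance
--     qr(q⁻¹(p)+r⁻¹(p)) + rp(r⁻¹(q)+p⁻¹(q)) + pq(p⁻¹(r)+q⁻¹(r))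
--       = qr·p + rp·q + pq·r + (p + q + r).
-- The excess p + q + r is positive but smaller than qr + rp + pq, the
-- excess forced if every sum exceeded its modulus.  So neither all three
-- inequalities hold nor none does, i.e. one or two of them hold.

open import Defs
open import Data.Nat
open import Data.Nat.Properties
open import Data.Nat.DivMod using (_%_; _/_; m≡m%n+[m/n]*n; [m+kn]%n≡m%n; m<n⇒m%n≡m)
open import Data.Nat.Divisibility using (_∣_; _∤_; divides; divides-refl; *-monoˡ-∣)
open import Data.Nat.Coprimality using (Coprime; coprime-divisor)
open import Data.Nat.Primality using (Prime; prime⇒irreducible; prime⇒nonTrivial)
open import Data.Nat.Tactic.RingSolver using (solve-∀)
open import Data.Bool using (true; false; T)
open import Data.Unit using (tt)
open import Data.Empty using (⊥; ⊥-elim)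
open import Data.Product using (_×_; _,_)
open import Data.Sum using (inj₁; inj₂)
open import Relation.Nullary using (¬_; contradiction)
open import Relation.Binary.PropositionalEquality

prime>1 : ∀ {p} → Prime p → 1 < p
prime>1 {p} pp = nonTrivial⇒n>1 p {{prime⇒nonTrivial pp}}

distinct-primes-coprime : ∀ {p q} → Prime p → Prime q → p ≢ q → Coprime p q
distinct-primes-coprime {p} {q} pp qp p≢q (d∣p , d∣q)
  with prime⇒irreducible pp d∣p
... | inj₁ d≡1 = d≡1
... | inj₂ refl with prime⇒irreducible qp d∣q
...   | inj₁ p≡1 = contradiction (sym p≡1) (<⇒≢ (prime>1 pp))
...   | inj₂ p≡q = contradiction p≡q p≢q

mod-one⇒∣pred : ∀ x n .{{_ : NonZero n}} → 1 < n → x % n ≡ 1 % n → n ∣ x ∸ 1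
mod-one⇒∣pred x n 1<n x≡1 = divides (x / n) (begin
  x ∸ 1                 ≡⟨ cong (_∸ 1) (m≡m%n+[m/n]*n x n) ⟩
  x % n + x / n * n ∸ 1 ≡⟨ cong (λ t → t + x / n * n ∸ 1) (trans x≡1 (m<n⇒m%n≡m 1<n)) ⟩
  x / n * n             ∎)
  where open ≡-Reasoning

coprime-∣-product : ∀ {m n o} → Coprime m n → m ∣ o → n ∣ o → m * n ∣ o
coprime-∣-product {m} {n} c m∣kn (divides-refl k) =
  *-monoˡ-∣ n (coprime-divisor c (subst (m ∣_) (*-comm k n) m∣kn))

multiple-below-double : ∀ {d y} → d ∣ y → 0 < y → y < d + d → y ≡ d
multiple-below-double (divides zero refl) () _
multiple-below-double {d} (divides (suc zero) refl) _ _ = +-identityʳ d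
multiple-below-double {d} (divides (suc (suc j)) refl) _ y<2d =
  contradiction (+-monoʳ-≤ d (m≤m+n d (j * d))) (<⇒≱ y<2d)

inverse-term-residue : ∀ m k a b .{{_ : NonZero m}} →
  (k * a) % m ≡ 1 % m → (k * a + m * b) % m ≡ 1 % m
inverse-term-residue m k a b ka≡1 = begin
  (k * a + m * b) % m ≡⟨ cong (λ t → (k * a + t) % m) (*-comm m b) ⟩
  (k * a + b * m) % m ≡⟨ [m+kn]%n≡m%n (k * a) b m ⟩
  (k * a) % m         ≡⟨ ka≡1 ⟩
  1 % m               ∎
  where open ≡-Reasoning

inverse-pair-sum : ∀ m n a b .{{_ : NonZero m}} .{{_ : NonZero n}} →
  1 < m → 1 < n → Coprime m n → IsInvMod n m a → IsInvMod m n b →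
  n * a + m * b ≡ 1 + m * n
inverse-pair-sum m n a b 1<m 1<n c (1≤a , a<m , na≡1) (1≤b , b<n , mb≡1) =
  begin
    x             ≡⟨ m+[n∸m]≡n 1≤x ⟨
    1 + (x ∸ 1)   ≡⟨ cong (1 +_) (multiple-below-double mn∣x-1 0<x-1 x-1<2mn) ⟩
    1 + m * n     ∎
  where
  open ≡-Reasoning
  x = n * a + m * b
  m∣x-1 : m ∣ x ∸ 1
  m∣x-1 = mod-one⇒∣pred x m 1<m (inverse-term-residue m n a b na≡1)
  n∣x-1 : n ∣ x ∸ 1
  n∣x-1 = mod-one⇒∣pred x n 1<n
    (subst (λ t → t % n ≡ 1 % n) (+-comm (m * b) (n * a)) (inverse-term-residue n m b a mb≡1))
  mn∣x-1 : m * n ∣ x ∸ 1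
  mn∣x-1 = coprime-∣-product c m∣x-1 n∣x-1
  2≤x : 2 ≤ x
  2≤x = +-mono-≤ (*-mono-≤ (<⇒≤ 1<n) 1≤a) (*-mono-≤ (<⇒≤ 1<m) 1≤b)
  1≤x : 1 ≤ x
  1≤x = <⇒≤ 2≤x
  0<x-1 : 0 < x ∸ 1
  0<x-1 = ∸-monoˡ-≤ 1 2≤x
  x-1<2mn : x ∸ 1 < m * n + m * n
  x-1<2mn = ≤-<-trans (m∸n≤m x 1)
    (+-mono-< (subst (n * a <_) (*-comm n m) (*-monoʳ-< n a<m)) (*-monoʳ-< m b<n))

weighted : (w₁ w₂ w₃ x₁ x₂ x₃ : ℕ) → ℕ
weighted w₁ w₂ w₃ x₁ x₂ x₃ = w₁ * x₁ + w₂ * x₂ + w₃ * x₃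

weighted-mono : ∀ w₁ w₂ w₃ {x₁ x₂ x₃ y₁ y₂ y₃} → x₁ ≤ y₁ → x₂ ≤ y₂ → x₃ ≤ y₃ →
  weighted w₁ w₂ w₃ x₁ x₂ x₃ ≤ weighted w₁ w₂ w₃ y₁ y₂ y₃
weighted-mono w₁ w₂ w₃ h₁ h₂ h₃ =
  +-mono-≤ (+-mono-≤ (*-monoʳ-≤ w₁ h₁) (*-monoʳ-≤ w₂ h₂)) (*-monoʳ-≤ w₃ h₃)

weighted-balance : ∀ p q r qp rp rq pq pr qr →
  q * qp + p * pq ≡ 1 + p * q → r * rp + p * pr ≡ 1 + p * r → r * rq + q * qr ≡ 1 + q * r →
  weighted (q * r) (r * p) (p * q) (qp + rp) (rq + pq) (pr + qr)
    ≡ weighted (q * r) (r * p) (p * q) p q r + (p + q + r)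
weighted-balance p q r qp rp rq pq pr qr E₁ E₂ E₃ = begin
  q * r * (qp + rp) + r * p * (rq + pq) + p * q * (pr + qr)
    ≡⟨ regroup p q r qp rp rq pq pr qr ⟩
  r * (q * qp + p * pq) + q * (r * rp + p * pr) + p * (r * rq + q * qr)
    ≡⟨ cong₂ _+_ (cong₂ _+_ (cong (r *_) E₁) (cong (q *_) E₂)) (cong (p *_) E₃) ⟩
  r * (1 + p * q) + q * (1 + p * r) + p * (1 + q * r)
    ≡⟨ expand p q r ⟩
  q * r * p + r * p * q + p * q * r + (p + q + r) ∎
  where
  open ≡-Reasoning
  regroup : ∀ p q r qp rp rq pq pr qr →
    q * r * (qp + rp) + r * p * (rq + pq) + p * q * (pr + qr)
      ≡ r * (q * qp + p * pq) + q * (r * rp + p * pr) + p * (r * rq + q * qr)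
  regroup = solve-∀
  expand : ∀ p q r → r * (1 + p * q) + q * (1 + p * r) + p * (1 + q * r)
      ≡ q * r * p + r * p * q + p * q * r + (p + q + r)
  expand = solve-∀

not-all-exceed : ∀ w₁ w₂ w₃ {s₁ s₂ s₃ m₁ m₂ m₃ c} →
  weighted w₁ w₂ w₃ s₁ s₂ s₃ ≡ weighted w₁ w₂ w₃ m₁ m₂ m₃ + c → c < w₁ + w₂ + w₃ →
  m₁ < s₁ → m₂ < s₂ → m₃ < s₃ → ⊥
not-all-exceed w₁ w₂ w₃ {s₁} {s₂} {s₃} {m₁} {m₂} {m₃} {c} balance c<w h₁ h₂ h₃ =
  <-irrefl refl (begin-strict
    M + c                              <⟨ +-monoʳ-< M c<w ⟩
    M + (w₁ + w₂ + w₃)                 ≡⟨ shift w₁ w₂ w₃ m₁ m₂ m₃ ⟩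
    weighted w₁ w₂ w₃ (suc m₁) (suc m₂) (suc m₃) ≤⟨ weighted-mono w₁ w₂ w₃ h₁ h₂ h₃ ⟩
    weighted w₁ w₂ w₃ s₁ s₂ s₃         ≡⟨ balance ⟩
    M + c                              ∎)
  where
  open ≤-Reasoning
  M = weighted w₁ w₂ w₃ m₁ m₂ m₃
  shift : ∀ w₁ w₂ w₃ m₁ m₂ m₃ → w₁ * m₁ + w₂ * m₂ + w₃ * m₃ + (w₁ + w₂ + w₃)
    ≡ w₁ * (1 + m₁) + w₂ * (1 + m₂) + w₃ * (1 + m₃)
  shift = solve-∀

not-all-within : ∀ w₁ w₂ w₃ {s₁ s₂ s₃ m₁ m₂ m₃ c} →
  weighted w₁ w₂ w₃ s₁ s₂ s₃ ≡ weighted w₁ w₂ w₃ m₁ m₂ m₃ + c → 0 < c →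
  s₁ ≤ m₁ → s₂ ≤ m₂ → s₃ ≤ m₃ → ⊥
not-all-within w₁ w₂ w₃ {s₁} {s₂} {s₃} {m₁} {m₂} {m₃} {c} balance 0<c h₁ h₂ h₃ =
  <-irrefl refl (begin-strict
    weighted w₁ w₂ w₃ s₁ s₂ s₃ ≤⟨ weighted-mono w₁ w₂ w₃ h₁ h₂ h₃ ⟩
    weighted w₁ w₂ w₃ m₁ m₂ m₃ <⟨ m<m+n _ 0<c ⟩
    weighted w₁ w₂ w₃ m₁ m₂ m₃ + c ≡⟨ balance ⟨
    weighted w₁ w₂ w₃ s₁ s₂ s₃ ∎)
  where open ≤-Reasoning

sum<pairwise-products : ∀ {p q r} → 1 < p → 1 < q → 1 < r → p + q + r < q * r + r * p + p * q
sum<pairwise-products {p} {q} {r} 1<p 1<q 1<r =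
  subst (_< q * r + r * p + p * q) (rotate p q r)
    (+-mono-< (+-mono-< (m<m*n q r 1<r) (m<m*n r p 1<p)) (m<m*n p q 1<q))
  where
  instance
    _ = >-nonZero (<-trans z<s 1<p)
    _ = >-nonZero (<-trans z<s 1<q)
    _ = >-nonZero (<-trans z<s 1<r)
  rotate : ∀ p q r → q + r + p ≡ p + q + r
  rotate = solve-∀

one-or-two-true : ∀ b₁ b₂ b₃ → (T b₁ → T b₂ → T b₃ → ⊥) → (¬ T b₁ → ¬ T b₂ → ¬ T b₃ → ⊥) →
  (1 ≤ ind b₁ + ind b₂ + ind b₃) × (ind b₁ + ind b₂ + ind b₃ ≤ 2)
one-or-two-true true  true  true  notAll _       = ⊥-elim (notAll tt tt tt)
one-or-two-true true  true  false _      _       = s≤s z≤n , ≤-refl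
one-or-two-true true  false true  _      _       = s≤s z≤n , ≤-refl
one-or-two-true true  false false _      _       = s≤s z≤n , s≤s z≤n
one-or-two-true false true  true  _      _       = s≤s z≤n , ≤-refl
one-or-two-true false true  false _      _       = s≤s z≤n , s≤s z≤n
one-or-two-true false false true  _      _       = s≤s z≤n , s≤s z≤n
one-or-two-true false false false _      notNone = ⊥-elim (notNone (λ ()) (λ ()) (λ ()))

countGreater-one-or-two : ∀ u₁ v₁ m₁ u₂ v₂ m₂ u₃ v₃ m₃ →
  (m₁ < u₁ + v₁ → m₂ < u₂ + v₂ → m₃ < u₃ + v₃ → ⊥) →
  (u₁ + v₁ ≤ m₁ → u₂ + v₂ ≤ m₂ → u₃ + v₃ ≤ m₃ → ⊥) →
  (1 ≤ countGreater u₁ v₁ m₁ u₂ v₂ m₂ u₃ v₃ m₃) × (countGreater u₁ v₁ m₁ u₂ v₂ m₂ u₃ v₃ m₃ ≤ 2)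
countGreater-one-or-two u₁ v₁ m₁ u₂ v₂ m₂ u₃ v₃ m₃ notAll notNone =
  one-or-two-true (m₁ <ᵇ u₁ + v₁) (m₂ <ᵇ u₂ + v₂) (m₃ <ᵇ u₃ + v₃)
    (λ h₁ h₂ h₃ → notAll (<ᵇ⇒< _ _ h₁) (<ᵇ⇒< _ _ h₂) (<ᵇ⇒< _ _ h₃))
    (λ h₁ h₂ h₃ → notNone (fails h₁) (fails h₂) (fails h₃))
  where
  fails : ∀ {m s} → ¬ T (m <ᵇ s) → s ≤ m
  fails ¬m<s = ≮⇒≥ (λ m<s → ¬m<s (<⇒<ᵇ m<s))

lemma3p3 : (p q r : ℕ) → Prime p → Prime q → Prime r → 2 ∤ p → 2 ∤ q → 2 ∤ r
    → p ≢ q → q ≢ r → p ≢ r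
    → .{{_ : NonZero p}} → .{{_ : NonZero q}} → .{{_ : NonZero r}}
    → (qp rp rq pq pr qr : ℕ)
    → IsInvMod q p qp → IsInvMod r p rp
    → IsInvMod r q rq → IsInvMod p q pq
    → IsInvMod p r pr → IsInvMod q r qr
    → (1 ≤ countGreater qp rp p rq pq q pr qr r) × (countGreater qp rp p rq pq q pr qr r ≤ 2)
lemma3p3 p q r pP qP rP _ _ _ p≢q q≢r p≢r qp rp rq pq pr qr qpInv rpInv rqInv pqInv prInv qrInv =
  countGreater-one-or-two qp rp p rq pq q pr qr r
    (not-all-exceed (q * r) (r * p) (p * q) balance (sum<pairwise-products 1<p 1<q 1<r))
    (not-all-within (q * r) (r * p) (p * q) balance
      (≤-trans (<⇒≤ 1<p) (≤-trans (m≤m+n p q) (m≤m+n (p + q) r))))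
  where
  1<p = prime>1 pP
  1<q = prime>1 qP
  1<r = prime>1 rP
  balance = weighted-balance p q r qp rp rq pq pr qr
    (inverse-pair-sum p q qp pq 1<p 1<q (distinct-primes-coprime pP qP p≢q) qpInv pqInv)
    (inverse-pair-sum p r rp pr 1<p 1<r (distinct-primes-coprime pP rP p≢r) rpInv prInv)
    (inverse-pair-sum q r rq qr 1<q 1<r (distinct-primes-coprime qP rP q≢r) rqInv qrInv)
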